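{- Let $\mathcal{L}\subseteq\mathbf{Z}^n$ be a lattice of dimension $m$ and $B\in\mathbf{Z}^{n\times m}$ a matrix whose columns form a basis of $\mathcal{L}$. Then $V_{\mathcal{L}}$ has the irreducible primary decomposition $$V_{\mathcal{L}}=\bigcap_{Q^{\bar\tau}_u}\langle x_i^{u_i+1} : i\in\bar\tau\rangle,$$ where the intersection is taken over all critical $Q^{\bar\tau}_u$ (with $u\in\mathbf{N}^n$, $\tau\subseteq[n]$).
   Context: $S=k[x_1,\ldots,x_n]$, $x^u=\prod_i x_i^{u_i}$, $[n]=\{1,\ldots,n\}$, $e_i$ the $i$-th unit vector. For $u\in\mathbf{N}^n$ the fiber is $P_u=\mathrm{conv}\{v\in\mathbf{N}^n: u-v\in\mathcal{L}\}$; the vertex ideal $V_{\mathcal{L}}$ is the monomial ideal spanned by monomials $x^v$ with $v$ not a vertex of $P_v$. For $\tau\subseteq[n]$ write $\bar\tau=[n]\setminus\tau$. For $u\in\mathbf{N}^n$, $Q^{\bar\tau}_u=\{x\in\mathbf{R}^m: B^{\bar\tau}x\le u^{\bar\tau}\}$ (only the rows/coordinates indexed by $\bar\tau$ are kept), and $R^{\bar\tau}_u$ is the convex hull of $Q^{\bar\tau}_u\cap\mathbf{Z}^m$. $Q^{\bar\tau}_u$ is called critical if the origin is a vertex of $R^{\bar\tau}_u$ but is not a vertex of $R^{\bar\tau}_{u+e_i}$ for any $i\in\bar\tau$. -}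

module Defs where

open import Data.Nat using (ℕ; zero; suc)
import Data.Nat as ℕ
open import Data.Integer as ℤ using (ℤ; +_)
open import Data.Rational as ℚ using (ℚ; 0ℚ; 1ℚ)
open import Data.Fin using (Fin; zero; suc)
open import Data.Fin.Subset using (Subset; _∉_)
open import Data.List using (List; []; _∷_; map)
open import Data.List.Relation.Unary.All using (All)
open import Data.Product using (Σ; ∃; _×_; _,_; proj₁; proj₂)
open import Relation.Nullary using (¬_)
open import Relation.Binary.PropositionalEquality using (_≡_)

sumℤ : ∀ {k} → (Fin k → ℤ) → ℤ
sumℤ {zero}  f = + 0
sumℤ {suc k} f = f zero ℤ.+ sumℤ (λ i → f (suc i))

sumℚ : List ℚ → ℚ
sumℚ []       = 0ℚ
sumℚ (x ∷ xs) = x ℚ.+ sumℚ xs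

Matℤ : ℕ → ℕ → Set
Matℤ n m = Fin n → Fin m → ℤ

mulVec : ∀ {n m} → Matℤ n m → (Fin m → ℤ) → Fin n → ℤ
mulVec B z i = sumℤ (λ j → B i j ℤ.* z j)

-- columns of B are linearly independent (B is a basis of the lattice it spans)
ColumnsIndependent : ∀ {n m} → Matℤ n m → Set
ColumnsIndependent B = ∀ z → (∀ i → mulVec B z i ≡ + 0) → ∀ j → z j ≡ + 0

InLattice : ∀ {n m} → Matℤ n m → (Fin n → ℤ) → Set
InLattice {m = m} B w = Σ (Fin m → ℤ) λ z → ∀ i → w i ≡ mulVec B z i

toℚ : ℤ → ℚ
toℚ z = z ℚ./ 1

InConv : ∀ {d} → ((Fin d → ℤ) → Set) → (Fin d → ℚ) → Set
InConv {d} S x =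
  Σ (List (ℚ × (Fin d → ℤ))) λ cs →
    All (λ c → (0ℚ ℚ.≤ proj₁ c) × S (proj₂ c)) cs
    × sumℚ (map proj₁ cs) ≡ 1ℚ
    × (∀ j → x j ≡ sumℚ (map (λ c → proj₁ c ℚ.* toℚ (proj₂ c j)) cs))

IsVertex : ∀ {d} → ((Fin d → ℤ) → Set) → (Fin d → ℚ) → Set
IsVertex {d} S x =
  InConv S x ×
  ¬ (Σ (Fin d → ℚ) λ p → Σ (Fin d → ℚ) λ q → Σ ℚ λ t →
       InConv S p × InConv S q × ¬ (∀ j → p j ≡ q j)
       × (0ℚ ℚ.< t) × (t ℚ.< 1ℚ)
       × (∀ j → x j ≡ t ℚ.* p j ℚ.+ (1ℚ ℚ.- t) ℚ.* q j))

-- lattice points of the fiber P_u = conv{ v ∈ ℕ^n : u - v ∈ L }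
FiberPts : ∀ {n m} → Matℤ n m → (Fin n → ℕ) → (Fin n → ℤ) → Set
FiberPts B u w = (∀ i → + 0 ℤ.≤ w i) × InLattice B (λ i → + u i ℤ.- w i)

-- exponent vector v of a monomial x^v in the vertex ideal V_L:
-- v is not a vertex of P_v
InVertexIdeal : ∀ {n m} → Matℤ n m → (Fin n → ℕ) → Set
InVertexIdeal B v = ¬ IsVertex (FiberPts B v) (λ i → toℚ (+ v i))

-- integer points of Q^{τ̄}_u = { x ∈ ℝ^m : (B x)_i ≤ u_i for i ∈ τ̄ }
QPts : ∀ {n m} → Matℤ n m → Subset n → (Fin n → ℕ) → (Fin m → ℤ) → Set
QPts B τ u z = ∀ i → i ∉ τ → mulVec B z i ℤ.≤ + u i

-- origin is a vertex of R^{τ̄}_u = conv(Q^{τ̄}_u ∩ ℤ^m)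
OriginVertexR : ∀ {n m} → Matℤ n m → Subset n → (Fin n → ℕ) → Set
OriginVertexR B τ u = IsVertex (QPts B τ u) (λ _ → 0ℚ)

addUnit : ∀ {n} → (Fin n → ℕ) → Fin n → Fin n → ℕ
addUnit u i j with i Data.Fin.≟ j
... | Relation.Nullary.yes _ = suc (u j)
... | Relation.Nullary.no  _ = u j

Critical : ∀ {n m} → Matℤ n m → Subset n → (Fin n → ℕ) → Set
Critical B τ u =
  OriginVertexR B τ u × (∀ i → i ∉ τ → ¬ OriginVertexR B τ (addUnit u i))

-- Monomial ideals are represented by their sets of exponent vectors.
-- x^v lies in the monomial ideal generated by the monomials {x^g : G g}
-- iff some generator divides it.
InMonomialIdealGen : ∀ {n} → ((Fin n → ℕ) → Set) → (Fin n → ℕ) → Set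
InMonomialIdealGen {n} G v = Σ (Fin n → ℕ) λ g → G g × (∀ i → g i ℕ.≤ v i)

-- exponent vectors of the generators x_i^{u_i+1}, i ∈ τ̄
IrredGens : ∀ {n} → Subset n → (Fin n → ℕ) → (Fin n → ℕ) → Set
IrredGens τ u g = ∃ λ i → i ∉ τ × (∀ j → g j ≡ addUnit (λ _ → 0) i j ℕ.* suc (u i))

{-# OPTIONS --safe #-}
module Submission where

-- The map y ↦ v − B y is affine and, the columns of B being independent,
-- injective on ℚ^m; it carries the integer points of Q^∅_v onto the lattice
-- points of the fiber P_v, so v is a vertex of P_v iff the origin is a vertex of
-- R^∅_v.  If x^v ∈ V_L and Q^τ̄_u is critical, some i ∈ τ̄ has u_i < v_i, for
-- otherwise Q^∅_v ⊆ Q^τ̄_u and the origin would be a vertex of R^∅_v.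
-- Conversely, if v is a vertex, start from (τ, u) = (∅, v) and treat the
-- coordinates i in turn: either the origin is a vertex of R^τ̄_{u + k e_i} for
-- every k, and then also for τ ∪ {i}, because a convex combination involves only
-- finitely many points; or it stops being one between k and k + 1, and u is
-- raised to u + k e_i.  This ends in a critical Q^τ̄_u with u ≥ v, whose component
-- ⟨x_i^{u_i+1} : i ∈ τ̄⟩ misses x^v.  The case distinction is classical; as this
-- half proves ⊥, it runs in the double-negation monad.

open import Defs
open import Algebra.Bundles using (CommutativeRing; Ring)
open import Data.Empty using (⊥-elim)
open import Data.Fin using (Fin; zero; suc; _≟_)
import Data.Fin.Properties as FinP
open import Data.Fin.Subset using (Subset; _∉_; _∪_; ⁅_⁆) renaming (⊥ to ∅; _⊆_ to _⊆ₛ_)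
import Data.Fin.Subset.Properties as SubP
open import Data.Integer as ℤ using (ℤ; +_; 0ℤ; 1ℤ)
import Data.Integer.Properties as ℤP
open import Data.Integer.Solver using () renaming (module +-*-Solver to ℤ-Solver)
open import Data.List using (List; []; _∷_; map; allFin)
import Data.List.Properties as LP
open import Data.List.Membership.Propositional.Properties using (∈-allFin)
open import Data.List.Relation.Unary.All as All using (All; []; _∷_)
import Data.List.Relation.Unary.All.Properties as AllP
open import Data.Nat as ℕ using (ℕ; zero; suc)
import Data.Nat.Properties as ℕP
open import Data.Product using (Σ; ∃; ∃₂; _×_; _,_; proj₁; proj₂; map₂)
open import Data.Rational as ℚ using (ℚ; 0ℚ; 1ℚ; ↥_; ↧_)
import Data.Rational.Properties as ℚP
open import Data.Rational.Solver using () renaming (module +-*-Solver to ℚ-Solver)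
open import Data.Rational.Unnormalised as ℚᵘ using (ℚᵘ; mkℚᵘ; *≡*)
import Data.Rational.Unnormalised.Properties as ℚᵘP
open import Data.Sum using (_⊎_; inj₁; inj₂; [_,_])
open import Effect.Monad using (RawMonad)
open import Function using (_∘_; id; _⇔_; mk⇔; Equivalence)
open import Level using (0ℓ)
open import Relation.Binary.PropositionalEquality hiding ([_])
open import Relation.Nullary using (¬_; ¬?; Dec; Stable; yes; no)
open import Relation.Nullary.Decidable using (_×-dec_; ¬¬-excluded-middle)
open import Relation.Nullary.Negation using (¬¬-map; ¬¬-Monad)
open import Relation.Unary using (Pred; _⊆_; ⋃)

open import Algebra.Properties.Semiring.Sum (Ring.semiring ℚP.+-*-ring)
  using (sum; sum-cong-≗; ∑-distrib-+; *-distribˡ-sum; sum-replicate-zero)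
open import Algebra.Properties.Group ℚP.+-0-group using (∙-cancelˡ; x∙y⁻¹≈ε⇒x≈y)
open import Algebra.Properties.Ring ℚP.+-*-ring using (-1*x≈-x)
open import Algebra.Properties.CommutativeSemigroup
  (CommutativeRing.*-commutativeSemigroup ℚP.+-*-commutativeRing) using (x∙yz≈y∙xz)

ι : ℤ → ℚᵘ
ι a = mkℚᵘ a 0

-- toℚ a = a / 1 is fromℚᵘ (ι a) by definition, so identities about toℚ can be
-- checked in ℚᵘ, where ι commutes with the ring operations up to ≃.
toℚᵘ-toℚ : ∀ a → ℚ.toℚᵘ (toℚ a) ℚᵘ.≃ ι a
toℚᵘ-toℚ a = ℚP.toℚᵘ-fromℚᵘ (ι a)

toℚ-injective : ∀ {a b} → toℚ a ≡ toℚ b → a ≡ b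
toℚ-injective {a} {b} eq with ℚP.fromℚᵘ-injective {ι a} {ι b} eq
... | *≡* a*1≡b*1 = trans (sym (ℤP.*-identityʳ a)) (trans a*1≡b*1 (ℤP.*-identityʳ b))

module _ where
  open ℚᵘP.≃-Reasoning
  open ℤ-Solver

  toℚ-homo-+ : ∀ a b → toℚ (a ℤ.+ b) ≡ toℚ a ℚ.+ toℚ b
  toℚ-homo-+ a b = ℚP.toℚᵘ-injective (begin
    ℚ.toℚᵘ (toℚ (a ℤ.+ b))              ≈⟨ toℚᵘ-toℚ (a ℤ.+ b) ⟩
    ι (a ℤ.+ b)
      ≈⟨ *≡* (solve 2 (λ a b → (a :+ b) :* con 1ℤ := (a :* con 1ℤ :+ b :* con 1ℤ) :* con 1ℤ) refl a b) ⟩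
    ι a ℚᵘ.+ ι b                         ≈⟨ ℚᵘP.+-cong (toℚᵘ-toℚ a) (toℚᵘ-toℚ b) ⟨
    ℚ.toℚᵘ (toℚ a) ℚᵘ.+ ℚ.toℚᵘ (toℚ b)  ≈⟨ ℚP.toℚᵘ-homo-+ (toℚ a) (toℚ b) ⟨
    ℚ.toℚᵘ (toℚ a ℚ.+ toℚ b)            ∎)

  toℚ-homo-* : ∀ a b → toℚ (a ℤ.* b) ≡ toℚ a ℚ.* toℚ b
  toℚ-homo-* a b = ℚP.toℚᵘ-injective (begin
    ℚ.toℚᵘ (toℚ (a ℤ.* b))              ≈⟨ toℚᵘ-toℚ (a ℤ.* b) ⟩
    ι (a ℤ.* b)                          ≈⟨ *≡* refl ⟩
    ι a ℚᵘ.* ι b                         ≈⟨ ℚᵘP.*-cong (toℚᵘ-toℚ a) (toℚᵘ-toℚ b) ⟨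
    ℚ.toℚᵘ (toℚ a) ℚᵘ.* ℚ.toℚᵘ (toℚ b)  ≈⟨ ℚP.toℚᵘ-homo-* (toℚ a) (toℚ b) ⟨
    ℚ.toℚᵘ (toℚ a ℚ.* toℚ b)            ∎)

  toℚ-homo-neg : ∀ a → toℚ (ℤ.- a) ≡ ℚ.- toℚ a
  toℚ-homo-neg a = ℚP.toℚᵘ-injective (begin
    ℚ.toℚᵘ (toℚ (ℤ.- a))    ≈⟨ toℚᵘ-toℚ (ℤ.- a) ⟩
    ℚᵘ.- ι a                ≈⟨ ℚᵘP.-‿cong (toℚᵘ-toℚ a) ⟨
    ℚᵘ.- ℚ.toℚᵘ (toℚ a)     ≈⟨ ℚP.toℚᵘ-homo‿- (toℚ a) ⟨
    ℚ.toℚᵘ (ℚ.- toℚ a)      ∎)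

  toℚ-denominator : ∀ p → toℚ (↧ p) ℚ.* p ≡ toℚ (↥ p)
  toℚ-denominator p@record{} = ℚP.toℚᵘ-injective (begin
    ℚ.toℚᵘ (toℚ (↧ p) ℚ.* p)         ≈⟨ ℚP.toℚᵘ-homo-* (toℚ (↧ p)) p ⟩
    ℚ.toℚᵘ (toℚ (↧ p)) ℚᵘ.* ℚ.toℚᵘ p  ≈⟨ ℚᵘP.*-congʳ (toℚᵘ-toℚ (↧ p)) ⟩
    ι (↧ p) ℚᵘ.* ℚ.toℚᵘ p
      ≈⟨ *≡* (solve 2 (λ n d → (d :* n) :* con 1ℤ := n :* (con 1ℤ :* d)) refl (↥ p) (↧ p)) ⟩
    ι (↥ p)                           ≈⟨ toℚᵘ-toℚ (↥ p) ⟨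
    ℚ.toℚᵘ (toℚ (↥ p))               ∎)

toℚ-homo-- : ∀ a b → toℚ (a ℤ.- b) ≡ toℚ a ℚ.- toℚ b
toℚ-homo-- a b = trans (toℚ-homo-+ a (ℤ.- b)) (cong (toℚ a ℚ.+_) (toℚ-homo-neg b))

toℚ-sumℤ : ∀ {k} (f : Fin k → ℤ) → toℚ (sumℤ f) ≡ sum (toℚ ∘ f)
toℚ-sumℤ {zero}  f = refl
toℚ-sumℤ {suc k} f = trans (toℚ-homo-+ (f zero) _) (cong (toℚ (f zero) ℚ.+_) (toℚ-sumℤ (f ∘ suc)))

toℚ-scale : ∀ {a b p} → toℚ a ℚ.* p ≡ toℚ b → ∀ c → toℚ (c ℤ.* a) ℚ.* p ≡ toℚ (c ℤ.* b)
toℚ-scale {a} {b} {p} ap≡b c = begin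
  toℚ (c ℤ.* a) ℚ.* p          ≡⟨ cong (ℚ._* p) (toℚ-homo-* c a) ⟩
  toℚ c ℚ.* toℚ a ℚ.* p        ≡⟨ ℚP.*-assoc (toℚ c) (toℚ a) p ⟩
  toℚ c ℚ.* (toℚ a ℚ.* p)      ≡⟨ cong (toℚ c ℚ.*_) ap≡b ⟩
  toℚ c ℚ.* toℚ b              ≡⟨ toℚ-homo-* c b ⟨
  toℚ (c ℤ.* b)                ∎
  where open ≡-Reasoning

*-cancelˡ-≢0 : ∀ p q → p ≢ 0ℚ → p ℚ.* q ≡ 0ℚ → q ≡ 0ℚ
*-cancelˡ-≢0 p q p≢0 pq≡0 = begin
  q                      ≡⟨ ℚP.*-identityˡ q ⟨
  1ℚ ℚ.* q               ≡⟨ cong (ℚ._* q) (ℚP.*-inverseˡ p) ⟨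
  (ℚ.1/ p) ℚ.* p ℚ.* q   ≡⟨ ℚP.*-assoc (ℚ.1/ p) p q ⟩
  (ℚ.1/ p) ℚ.* (p ℚ.* q) ≡⟨ cong ((ℚ.1/ p) ℚ.*_) pq≡0 ⟩
  (ℚ.1/ p) ℚ.* 0ℚ        ≡⟨ ℚP.*-zeroʳ (ℚ.1/ p) ⟩
  0ℚ                     ∎
  where
  open ≡-Reasoning
  instance
    p-nonZero : ℚ.NonZero p
    p-nonZero = ℚ.≢-nonZero p≢0

clearDenominators : ∀ {k} (y : Fin k → ℚ) →
  ∃₂ λ (D : ℤ) (z : Fin k → ℤ) → D ≢ 0ℤ × (∀ j → toℚ D ℚ.* y j ≡ toℚ (z j))
clearDenominators {zero}  y = 1ℤ , (λ ()) , (λ ()) , (λ ())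
clearDenominators {suc k} y with clearDenominators (y ∘ suc)
... | D , z , D≢0 , Dy≡z = D ℤ.* d , z′ , D*d≢0 , Dd*y≡z′
  where
  d : ℤ
  d = ↧ (y zero)
  z′ : Fin (suc k) → ℤ
  z′ zero    = D ℤ.* ↥ (y zero)
  z′ (suc j) = d ℤ.* z j
  D*d≢0 : D ℤ.* d ≢ 0ℤ
  D*d≢0 = [ D≢0 , (λ ()) ] ∘ ℤP.i*j≡0⇒i≡0∨j≡0 D
  Dd*y≡z′ : ∀ j → toℚ (D ℤ.* d) ℚ.* y j ≡ toℚ (z′ j)
  Dd*y≡z′ zero    = toℚ-scale {d} {↥ (y zero)} (toℚ-denominator (y zero)) D
  Dd*y≡z′ (suc j) = trans (cong (λ c → toℚ c ℚ.* y (suc j)) (ℤP.*-comm D d)) (toℚ-scale {D} {z j} (Dy≡z j) d)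

mulVecℚ : ∀ {n m} → Matℤ n m → (Fin m → ℚ) → Fin n → ℚ
mulVecℚ B y i = sum (λ j → toℚ (B i j) ℚ.* y j)

module _ {n m} (B : Matℤ n m) where

  mulVecℚ-cong : ∀ {y y′} → (∀ j → y j ≡ y′ j) → ∀ i → mulVecℚ B y i ≡ mulVecℚ B y′ i
  mulVecℚ-cong y≗y′ i = sum-cong-≗ (cong (toℚ (B i _) ℚ.*_) ∘ y≗y′)

  mulVecℚ-zero : ∀ i → mulVecℚ B (λ _ → 0ℚ) i ≡ 0ℚ
  mulVecℚ-zero i = trans (sum-cong-≗ (ℚP.*-zeroʳ ∘ toℚ ∘ B i)) (sum-replicate-zero m)

  mulVecℚ-+ : ∀ p q i → mulVecℚ B (λ j → p j ℚ.+ q j) i ≡ mulVecℚ B p i ℚ.+ mulVecℚ B q i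
  mulVecℚ-+ p q i =
    trans (sum-cong-≗ (λ j → ℚP.*-distribˡ-+ (toℚ (B i j)) (p j) (q j)))
          (∑-distrib-+ (λ j → toℚ (B i j) ℚ.* p j) (λ j → toℚ (B i j) ℚ.* q j))

  mulVecℚ-* : ∀ a p i → mulVecℚ B (λ j → a ℚ.* p j) i ≡ a ℚ.* mulVecℚ B p i
  mulVecℚ-* a p i =
    trans (sum-cong-≗ (λ j → x∙yz≈y∙xz (toℚ (B i j)) a (p j)))
          (sym (*-distribˡ-sum a (λ j → toℚ (B i j) ℚ.* p j)))

  mulVecℚ-neg : ∀ p i → mulVecℚ B (λ j → ℚ.- p j) i ≡ ℚ.- mulVecℚ B p i
  mulVecℚ-neg p i = begin
    mulVecℚ B (λ j → ℚ.- p j) i             ≡⟨ mulVecℚ-cong (sym ∘ -1*x≈-x ∘ p) i ⟩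
    mulVecℚ B (λ j → ℚ.- 1ℚ ℚ.* p j) i      ≡⟨ mulVecℚ-* (ℚ.- 1ℚ) p i ⟩
    ℚ.- 1ℚ ℚ.* mulVecℚ B p i                ≡⟨ -1*x≈-x _ ⟩
    ℚ.- mulVecℚ B p i                       ∎
    where open ≡-Reasoning

  mulVecℚ-toℚ : ∀ z i → mulVecℚ B (toℚ ∘ z) i ≡ toℚ (mulVec B z i)
  mulVecℚ-toℚ z i =
    sym (trans (toℚ-sumℤ (λ j → B i j ℤ.* z j)) (sum-cong-≗ (λ j → toℚ-homo-* (B i j) (z j))))

  mulVecℚ-kernel : ColumnsIndependent B → ∀ y → (∀ i → mulVecℚ B y i ≡ 0ℚ) → ∀ j → y j ≡ 0ℚ
  mulVecℚ-kernel indep y By≡0 j with clearDenominators y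
  ... | D , z , D≢0 , Dy≡z =
    *-cancelˡ-≢0 (toℚ D) (y j) (D≢0 ∘ toℚ-injective) (trans (Dy≡z j) (cong toℚ (indep z Bz≡0 j)))
    where
    open ≡-Reasoning
    Bz≡0 : ∀ i → mulVec B z i ≡ 0ℤ
    Bz≡0 i = toℚ-injective (begin
      toℚ (mulVec B z i)                       ≡⟨ mulVecℚ-toℚ z i ⟨
      mulVecℚ B (toℚ ∘ z) i                    ≡⟨ mulVecℚ-cong (sym ∘ Dy≡z) i ⟩
      mulVecℚ B (λ j → toℚ D ℚ.* y j) i        ≡⟨ mulVecℚ-* (toℚ D) y i ⟩
      toℚ D ℚ.* mulVecℚ B y i                  ≡⟨ cong (toℚ D ℚ.*_) (By≡0 i) ⟩
      toℚ D ℚ.* 0ℚ                             ≡⟨ ℚP.*-zeroʳ (toℚ D) ⟩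
      0ℚ                                       ∎)

  mulVecℚ-injective : ColumnsIndependent B → ∀ {p q} →
    (∀ i → mulVecℚ B p i ≡ mulVecℚ B q i) → ∀ j → p j ≡ q j
  mulVecℚ-injective indep {p} {q} Bp≡Bq j =
    x∙y⁻¹≈ε⇒x≈y (p j) (q j) (mulVecℚ-kernel indep (λ j → p j ℚ.- q j) B[p-q]≡0 j)
    where
    B[p-q]≡0 : ∀ i → mulVecℚ B (λ j → p j ℚ.- q j) i ≡ 0ℚ
    B[p-q]≡0 i = begin
      mulVecℚ B (λ j → p j ℚ.- q j) i              ≡⟨ mulVecℚ-+ p (λ j → ℚ.- q j) i ⟩
      mulVecℚ B p i ℚ.+ mulVecℚ B (λ j → ℚ.- q j) i ≡⟨ cong₂ ℚ._+_ (Bp≡Bq i) (mulVecℚ-neg q i) ⟩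
      mulVecℚ B q i ℚ.- mulVecℚ B q i              ≡⟨ ℚP.+-inverseʳ (mulVecℚ B q i) ⟩
      0ℚ                                           ∎
      where open ≡-Reasoning

-- Convex hulls of integer points

totalWeight : ∀ {A : Set} → List (ℚ × A) → ℚ
totalWeight cs = sumℚ (map proj₁ cs)

weightedSum : ∀ {A : Set} → List (ℚ × A) → (A → ℚ) → ℚ
weightedSum cs h = sumℚ (map (λ c → proj₁ c ℚ.* h (proj₂ c)) cs)

barycenter : ∀ {d} → List (ℚ × (Fin d → ℤ)) → Fin d → ℚ
barycenter cs j = weightedSum cs (λ z → toℚ (z j))

module _ {A : Set} where

  weightedSum-cong : ∀ cs {h h′ : A → ℚ} → (∀ a → h a ≡ h′ a) → weightedSum cs h ≡ weightedSum cs h′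
  weightedSum-cong []       h≗h′ = refl
  weightedSum-cong (c ∷ cs) h≗h′ =
    cong₂ ℚ._+_ (cong (proj₁ c ℚ.*_) (h≗h′ (proj₂ c))) (weightedSum-cong cs h≗h′)

  weightedSum-map₂ : ∀ {C : Set} (g : A → C) cs (h : C → ℚ) →
    weightedSum (map (map₂ g) cs) h ≡ weightedSum cs (h ∘ g)
  weightedSum-map₂ g []       h = refl
  weightedSum-map₂ g (c ∷ cs) h = cong (proj₁ c ℚ.* h (g (proj₂ c)) ℚ.+_) (weightedSum-map₂ g cs h)

  weightedSum-const-minus : ∀ cs a (h : A → ℚ) →
    weightedSum cs (λ x → a ℚ.- h x) ≡ a ℚ.* totalWeight cs ℚ.- weightedSum cs h
  weightedSum-const-minus []       a h = cong (ℚ._- 0ℚ) (sym (ℚP.*-zeroʳ a))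
  weightedSum-const-minus (c ∷ cs) a h =
    trans (cong (proj₁ c ℚ.* (a ℚ.- h (proj₂ c)) ℚ.+_) (weightedSum-const-minus cs a h))
          (solve 5 (λ w a x W S → w :* (a :- x) :+ (a :* W :- S) := a :* (w :+ W) :- (w :* x :+ S))
                 refl (proj₁ c) a (h (proj₂ c)) (totalWeight cs) (weightedSum cs h))
    where open ℚ-Solver

combination : ∀ {d} → ℚ → (Fin d → ℚ) → (Fin d → ℚ) → Fin d → ℚ
combination t p q j = t ℚ.* p j ℚ.+ (1ℚ ℚ.- t) ℚ.* q j

InOpenSegment : ∀ {d} → Pred (Fin d → ℤ) 0ℓ → (Fin d → ℚ) → Set
InOpenSegment {d} S x =
  Σ (Fin d → ℚ) λ p → Σ (Fin d → ℚ) λ q → Σ ℚ λ t →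
    InConv S p × InConv S q × ¬ (∀ j → p j ≡ q j) × (0ℚ ℚ.< t) × (t ℚ.< 1ℚ)
    × (∀ j → x j ≡ combination t p q j)

module _ {n m} (B : Matℤ n m) where

  mulVecℚ-barycenter : ∀ cs i → mulVecℚ B (barycenter cs) i ≡ weightedSum cs (λ z → toℚ (mulVec B z i))
  mulVecℚ-barycenter []             i = mulVecℚ-zero B i
  mulVecℚ-barycenter ((w , z) ∷ cs) i = begin
    mulVecℚ B (λ j → w ℚ.* toℚ (z j) ℚ.+ barycenter cs j) i
      ≡⟨ mulVecℚ-+ B (λ j → w ℚ.* toℚ (z j)) (barycenter cs) i ⟩
    mulVecℚ B (λ j → w ℚ.* toℚ (z j)) i ℚ.+ mulVecℚ B (barycenter cs) i
      ≡⟨ cong₂ ℚ._+_ (mulVecℚ-* B w (toℚ ∘ z) i) (mulVecℚ-barycenter cs i) ⟩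
    w ℚ.* mulVecℚ B (toℚ ∘ z) i ℚ.+ weightedSum cs (λ z → toℚ (mulVec B z i))
      ≡⟨ cong (λ b → w ℚ.* b ℚ.+ _) (mulVecℚ-toℚ B z i) ⟩
    w ℚ.* toℚ (mulVec B z i) ℚ.+ weightedSum cs (λ z → toℚ (mulVec B z i))
      ∎
    where open ≡-Reasoning

  mulVecℚ-combination : ∀ t p q i →
    mulVecℚ B (combination t p q) i ≡ combination t (mulVecℚ B p) (mulVecℚ B q) i
  mulVecℚ-combination t p q i =
    trans (mulVecℚ-+ B (λ j → t ℚ.* p j) (λ j → (1ℚ ℚ.- t) ℚ.* q j) i)
          (cong₂ ℚ._+_ (mulVecℚ-* B t p i) (mulVecℚ-* B (1ℚ ℚ.- t) q i))

module _ {d} {S : Pred (Fin d → ℤ) 0ℓ} where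

  InConv-resp : ∀ {x x′} → (∀ j → x j ≡ x′ j) → InConv S x → InConv S x′
  InConv-resp x≗x′ (cs , pts , total , x≗) = cs , pts , total , λ j → trans (sym (x≗x′ j)) (x≗ j)

  InConv-singleton : ∀ {z} → S z → InConv S (toℚ ∘ z)
  InConv-singleton z∈S = (1ℚ , _) ∷ [] , (ℚP.nonNegative⁻¹ 1ℚ , z∈S) ∷ [] , refl ,
    λ j → sym (trans (ℚP.+-identityʳ _) (ℚP.*-identityˡ _))

  module _ {T : Pred (Fin d → ℤ) 0ℓ} (S⊆T : S ⊆ T) where

    InConv-mono : ∀ {x} → InConv S x → InConv T x
    InConv-mono (cs , pts , total , x≗) = cs , All.map (map₂ S⊆T) pts , total , x≗

    InOpenSegment-mono : ∀ {x} → InOpenSegment S x → InOpenSegment T x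
    InOpenSegment-mono (p , q , t , p∈ , q∈ , rest) = p , q , t , InConv-mono p∈ , InConv-mono q∈ , rest

    IsVertex-antitone : ∀ {x} → InConv S x → IsVertex T x → IsVertex S x
    IsVertex-antitone x∈S (_ , x-extreme) = x∈S , x-extreme ∘ InOpenSegment-mono

module _ {A : Set} {P : ℕ → Pred A 0ℓ} (P-chain : ∀ k → P k ⊆ P (suc k)) where

  chain-mono : ∀ {j k} → j ℕ.≤ k → P j ⊆ P k
  chain-mono = go ∘ ℕP.≤⇒≤′
    where
    go : ∀ {j k} → j ℕ.≤′ k → P j ⊆ P k
    go ℕ.≤′-refl        = id
    go (ℕ.≤′-step j≤′k) = P-chain _ ∘ go j≤′k

  All-⋃ : ∀ {xs} → All (⋃ ℕ P) xs → ∃ λ k → All (P k) xs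
  All-⋃ []               = 0 , []
  All-⋃ ((k , x∈) ∷ xs∈) with All-⋃ xs∈
  ... | l , xs∈l = k ℕ.⊔ l , chain-mono (ℕP.m≤m⊔n k l) x∈ ∷ All.map (chain-mono (ℕP.m≤n⊔m k l)) xs∈l

-- A convex combination involves finitely many points, so it already lives in
-- some member of an increasing union.
module _ {d} {S : ℕ → Pred (Fin d → ℤ) 0ℓ} (S-chain : ∀ k → S k ⊆ S (suc k)) where

  InConv-⋃ : ∀ {x} → InConv (⋃ ℕ S) x → ∃ λ k → InConv (S k) x
  InConv-⋃ (cs , pts , total , x≗) with All-⋃ {P = λ k c → 0ℚ ℚ.≤ proj₁ c × S k (proj₂ c)}
                                                (λ k → map₂ (S-chain k))
                                                (All.map (λ (0≤w , k , z∈) → k , 0≤w , z∈) pts)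
  ... | k , ptsₖ = k , cs , ptsₖ , total , x≗

  IsVertex-⋃ : ∀ {x} → InConv (⋃ ℕ S) x → (∀ k → IsVertex (S k) x) → IsVertex (⋃ ℕ S) x
  IsVertex-⋃ x∈ vertex = x∈ , λ (p , q , t , p∈ , q∈ , rest) →
    let (k , p∈ₖ) = InConv-⋃ p∈
        (l , q∈ₗ) = InConv-⋃ q∈
    in proj₂ (vertex (k ℕ.⊔ l))
         ( p , q , t
         , InConv-mono (chain-mono S-chain (ℕP.m≤m⊔n k l)) p∈ₖ
         , InConv-mono (chain-mono S-chain (ℕP.m≤n⊔m k l)) q∈ₗ
         , rest )

record AffineEmbedding {d e} (S : Pred (Fin d → ℤ) 0ℓ) (T : Pred (Fin e → ℤ) 0ℓ) : Set where
  field
    φ            : (Fin d → ℚ) → Fin e → ℚ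
    φ-cong       : ∀ {p q} → (∀ j → p j ≡ q j) → ∀ i → φ p i ≡ φ q i
    φ-injective  : ∀ {p q} → (∀ i → φ p i ≡ φ q i) → ∀ j → p j ≡ q j
    φ-affine     : ∀ t p q i → φ (combination t p q) i ≡ combination t (φ p) (φ q) i
    φℤ           : (Fin d → ℤ) → Fin e → ℤ
    φℤ-maps      : ∀ {z} → S z → T (φℤ z)
    φℤ-onto      : ∀ {w} → T w → ∃ λ z → S z × (∀ i → φℤ z i ≡ w i)
    φ-barycenter : ∀ cs → totalWeight cs ≡ 1ℚ → ∀ i → φ (barycenter cs) i ≡ weightedSum cs (λ z → toℚ (φℤ z i))

module _ {d e} {S : Pred (Fin d → ℤ) 0ℓ} {T : Pred (Fin e → ℤ) 0ℓ} (E : AffineEmbedding S T) where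
  open AffineEmbedding E

  InConv-image : ∀ {x} → InConv S x → InConv T (φ x)
  InConv-image (cs , pts , total , x≗) =
    map (map₂ φℤ) cs ,
    AllP.map⁺ (All.map (map₂ φℤ-maps) pts) ,
    trans (cong sumℚ (sym (LP.map-∘ cs))) total ,
    λ i → trans (φ-cong x≗ i) (trans (φ-barycenter cs total i) (sym (weightedSum-map₂ φℤ cs (λ w → toℚ (w i)))))

  private
    liftPoints : ∀ cs → All (λ c → 0ℚ ℚ.≤ proj₁ c × T (proj₂ c)) cs →
      ∃ λ cs′ → All (λ c → 0ℚ ℚ.≤ proj₁ c × S (proj₂ c)) cs′ × map proj₁ cs′ ≡ map proj₁ cs
              × (∀ i → weightedSum cs′ (λ z → toℚ (φℤ z i)) ≡ barycenter cs i)
    liftPoints []             []                  = [] , [] , refl , λ _ → refl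
    liftPoints ((w , _) ∷ cs) ((0≤w , w∈T) ∷ pts) with φℤ-onto w∈T | liftPoints cs pts
    ... | z , z∈S , φz≗ | cs′ , pts′ , weights , bary =
      (w , z) ∷ cs′ , (0≤w , z∈S) ∷ pts′ , cong (w ∷_) weights ,
      λ i → cong₂ ℚ._+_ (cong (λ a → w ℚ.* toℚ a) (φz≗ i)) (bary i)

  InConv-preimage : ∀ {y} → InConv T y → ∃ λ x → InConv S x × (∀ i → φ x i ≡ y i)
  InConv-preimage (cs , pts , total , y≗) with liftPoints cs pts
  ... | cs′ , pts′ , weights , bary =
    barycenter cs′ , (cs′ , pts′ , total′ , λ _ → refl) ,
    λ i → trans (φ-barycenter cs′ total′ i) (trans (bary i) (sym (y≗ i)))
    where
    total′ : totalWeight cs′ ≡ 1ℚ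
    total′ = trans (cong sumℚ weights) total

  module _ {x : Fin d → ℚ} {y : Fin e → ℚ} (φx≗y : ∀ i → φ x i ≡ y i) where

    InOpenSegment-image : InOpenSegment S x → InOpenSegment T y
    InOpenSegment-image (p , q , t , p∈ , q∈ , p≢q , 0<t , t<1 , x≗) =
      φ p , φ q , t , InConv-image p∈ , InConv-image q∈ , p≢q ∘ φ-injective , 0<t , t<1 ,
      λ i → trans (sym (φx≗y i)) (trans (φ-cong x≗ i) (φ-affine t p q i))

    InOpenSegment-preimage : InOpenSegment T y → InOpenSegment S x
    InOpenSegment-preimage (p , q , t , p∈ , q∈ , p≢q , 0<t , t<1 , y≗)
      with InConv-preimage p∈ | InConv-preimage q∈
    ... | p′ , p′∈ , φp′≗p | q′ , q′∈ , φq′≗q =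
      p′ , q′ , t , p′∈ , q′∈ , p′≢q′ , 0<t , t<1 , φ-injective φx≗φ[combination]
      where
      open ≡-Reasoning
      p′≢q′ : ¬ (∀ j → p′ j ≡ q′ j)
      p′≢q′ p′≗q′ = p≢q λ i → trans (sym (φp′≗p i)) (trans (φ-cong p′≗q′ i) (φq′≗q i))
      φx≗φ[combination] : ∀ i → φ x i ≡ φ (combination t p′ q′) i
      φx≗φ[combination] i = begin
        φ x i                                ≡⟨ φx≗y i ⟩
        y i                                  ≡⟨ y≗ i ⟩
        combination t p q i                  ≡⟨ cong₂ (λ a b → t ℚ.* a ℚ.+ (1ℚ ℚ.- t) ℚ.* b) (φp′≗p i) (φq′≗q i) ⟨
        combination t (φ p′) (φ q′) i        ≡⟨ φ-affine t p′ q′ i ⟨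
        φ (combination t p′ q′) i            ∎

    IsVertex-transport : IsVertex S x ⇔ IsVertex T y
    IsVertex-transport = mk⇔
      (λ (x∈S , x-extreme) → InConv-resp φx≗y (InConv-image x∈S) , x-extreme ∘ InOpenSegment-preimage)
      (λ (y∈T , y-extreme) → x∈S y∈T , y-extreme ∘ InOpenSegment-image)
      where
      x∈S : InConv T y → InConv S x
      x∈S y∈T with InConv-preimage y∈T
      ... | x′ , x′∈S , φx′≗y = InConv-resp (φ-injective λ i → trans (φx′≗y i) (sym (φx≗y i))) x′∈S

-- The fiber of v as an affine image of Q^∅_v

module _ {n m} (B : Matℤ n m) (v : Fin n → ℕ) where

  fiberPoint : (Fin m → ℚ) → Fin n → ℚ
  fiberPoint y i = toℚ (+ v i) ℚ.- mulVecℚ B y i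

  fiberPointℤ : (Fin m → ℤ) → Fin n → ℤ
  fiberPointℤ z i = + v i ℤ.- mulVec B z i

  private
    a-[a-b]≡b : ∀ a b → a ℤ.- (a ℤ.- b) ≡ b
    a-[a-b]≡b = solve 2 (λ a b → a :- (a :- b) := b) refl
      where open ℤ-Solver

  fiberPoint-origin : ∀ i → fiberPoint (λ _ → 0ℚ) i ≡ toℚ (+ v i)
  fiberPoint-origin i = trans (cong (λ b → toℚ (+ v i) ℚ.- b) (mulVecℚ-zero B i)) (ℚP.+-identityʳ (toℚ (+ v i)))

  fiberPoint-affine : ∀ t p q i → fiberPoint (combination t p q) i ≡ combination t (fiberPoint p) (fiberPoint q) i
  fiberPoint-affine t p q i =
    trans (cong (λ b → toℚ (+ v i) ℚ.- b) (mulVecℚ-combination B t p q i))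
          (solve 4 (λ t V a b → V :- (t :* a :+ (con 1ℚ :- t) :* b) := t :* (V :- a) :+ (con 1ℚ :- t) :* (V :- b))
                 refl t (toℚ (+ v i)) (mulVecℚ B p i) (mulVecℚ B q i))
    where open ℚ-Solver

  fiberPoint-barycenter : ∀ cs → totalWeight cs ≡ 1ℚ → ∀ i →
    fiberPoint (barycenter cs) i ≡ weightedSum cs (λ z → toℚ (fiberPointℤ z i))
  fiberPoint-barycenter cs total i = begin
    V ℚ.- mulVecℚ B (barycenter cs) i            ≡⟨ cong (λ b → V ℚ.- b) (mulVecℚ-barycenter B cs i) ⟩
    V ℚ.- weightedSum cs Bz                      ≡⟨ cong (ℚ._- weightedSum cs Bz) (ℚP.*-identityʳ V) ⟨
    V ℚ.* 1ℚ ℚ.- weightedSum cs Bz               ≡⟨ cong (λ W → V ℚ.* W ℚ.- weightedSum cs Bz) total ⟨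
    V ℚ.* totalWeight cs ℚ.- weightedSum cs Bz   ≡⟨ weightedSum-const-minus cs V Bz ⟨
    weightedSum cs (λ z → V ℚ.- Bz z)            ≡⟨ weightedSum-cong cs (λ z → toℚ-homo-- (+ v i) (mulVec B z i)) ⟨
    weightedSum cs (λ z → toℚ (fiberPointℤ z i)) ∎
    where
    open ≡-Reasoning
    V : ℚ
    V = toℚ (+ v i)
    Bz : (Fin m → ℤ) → ℚ
    Bz z = toℚ (mulVec B z i)

  fiberEmbedding : ColumnsIndependent B → AffineEmbedding (QPts B ∅ v) (FiberPts B v)
  fiberEmbedding indep = record
    { φ            = fiberPoint
    ; φ-cong       = λ p≗q i → cong (λ b → toℚ (+ v i) ℚ.- b) (mulVecℚ-cong B p≗q i)
    ; φ-injective  = λ φp≗φq → mulVecℚ-injective B indep λ i →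
                       ℚP.neg-injective (∙-cancelˡ (toℚ (+ v i)) _ _ (φp≗φq i))
    ; φ-affine     = fiberPoint-affine
    ; φℤ           = fiberPointℤ
    ; φℤ-maps      = λ {z} Bz≤v →
                       (λ i → ℤP.i≤j⇒0≤j-i (Bz≤v i SubP.∉⊥)) , z , λ i → a-[a-b]≡b (+ v i) (mulVec B z i)
    ; φℤ-onto      = λ (0≤w , z , v-w≡Bz) →
                       z ,
                       (λ i _ → subst (ℤ._≤ + v i) (v-w≡Bz i) (ℤP.i-j≤i (+ v i) _ {{ℤ.nonNegative (0≤w i)}})) ,
                       λ i → trans (cong (λ b → + v i ℤ.- b) (sym (v-w≡Bz i))) (a-[a-b]≡b (+ v i) _)
    ; φ-barycenter = fiberPoint-barycenter
    }

  originVertex⇔fiberVertex : ColumnsIndependent B →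
    OriginVertexR B ∅ v ⇔ IsVertex (FiberPts B v) (λ i → toℚ (+ v i))
  originVertex⇔fiberVertex indep = IsVertex-transport (fiberEmbedding indep) fiberPoint-origin

-- The polyhedra Q^τ̄_u

addUnits : ∀ {n} → (Fin n → ℕ) → Fin n → ℕ → Fin n → ℕ
addUnits u i zero    = u
addUnits u i (suc k) = addUnit (addUnits u i k) i

module _ {n : ℕ} where

  addUnit-self : ∀ (u : Fin n → ℕ) i → addUnit u i i ≡ suc (u i)
  addUnit-self u i with i ≟ i
  ... | yes _   = refl
  ... | no  i≢i = ⊥-elim (i≢i refl)

  ≤-addUnit : ∀ (u : Fin n → ℕ) i j → u j ℕ.≤ addUnit u i j
  ≤-addUnit u i j with i ≟ j
  ... | yes _ = ℕP.n≤1+n (u j)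
  ... | no  _ = ℕP.≤-refl

  addUnit-mono : ∀ {u u′ : Fin n → ℕ} i → (∀ j → u j ℕ.≤ u′ j) → ∀ j → addUnit u i j ℕ.≤ addUnit u′ i j
  addUnit-mono i u≤u′ j with i ≟ j
  ... | yes _ = ℕ.s≤s (u≤u′ j)
  ... | no  _ = u≤u′ j

  ≤-addUnits : ∀ (u : Fin n → ℕ) i k j → u j ℕ.≤ addUnits u i k j
  ≤-addUnits u i zero    j = ℕP.≤-refl
  ≤-addUnits u i (suc k) j = ℕP.≤-trans (≤-addUnits u i k j) (≤-addUnit (addUnits u i k) i j)

  ≤-addUnits-self : ∀ (u : Fin n → ℕ) i k → k ℕ.≤ addUnits u i k i
  ≤-addUnits-self u i zero    = ℕ.z≤n
  ≤-addUnits-self u i (suc k) =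
    subst (suc k ℕ.≤_) (sym (addUnit-self (addUnits u i k) i)) (ℕ.s≤s (≤-addUnits-self u i k))

i≤+∣i∣ : ∀ a → a ℤ.≤ + ℤ.∣ a ∣
i≤+∣i∣ (+ _)      = ℤP.≤-refl
i≤+∣i∣ ℤ.-[1+ _ ] = ℤ.-≤+

module _ {n m} (B : Matℤ n m) where

  mulVec-zero : ∀ i → mulVec B (λ _ → 0ℤ) i ≡ 0ℤ
  mulVec-zero i = toℚ-injective (trans (sym (mulVecℚ-toℚ B (λ _ → 0ℤ) i)) (mulVecℚ-zero B i))

  QPts-mono : ∀ {τ τ′ u u′} → τ ⊆ₛ τ′ → (∀ i → i ∉ τ′ → u i ℕ.≤ u′ i) → QPts B τ u ⊆ QPts B τ′ u′
  QPts-mono τ⊆τ′ u≤u′ Bz≤u i i∉τ′ = ℤP.≤-trans (Bz≤u i (i∉τ′ ∘ τ⊆τ′)) (ℤ.+≤+ (u≤u′ i i∉τ′))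

  origin∈QPts : ∀ {τ u} → QPts B τ u (λ _ → 0ℤ)
  origin∈QPts {u = u} i _ = subst (ℤ._≤ + u i) (sym (mulVec-zero i)) (ℤ.+≤+ ℕ.z≤n)

  origin∈convQ : ∀ {τ u} → InConv (QPts B τ u) (λ _ → 0ℚ)
  origin∈convQ = InConv-singleton origin∈QPts

  OriginVertexR-antitone : ∀ {τ τ′ u u′} → τ ⊆ₛ τ′ → (∀ i → i ∉ τ′ → u i ℕ.≤ u′ i) →
    OriginVertexR B τ′ u′ → OriginVertexR B τ u
  OriginVertexR-antitone τ⊆τ′ u≤u′ = IsVertex-antitone (QPts-mono τ⊆τ′ u≤u′) origin∈convQ

  OriginVertexR-stable : ∀ {τ u} → Stable (OriginVertexR B τ u)
  OriginVertexR-stable ¬¬ov = origin∈convQ , λ inSegment → ¬¬ov λ ov → proj₂ ov inSegment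

  module _ {τ : Subset n} {u : Fin n → ℕ} (i : Fin n) where

    QPts-⋃ : QPts B (τ ∪ ⁅ i ⁆) u ⊆ ⋃ ℕ (λ k → QPts B τ (addUnits u i k))
    QPts-⋃ {z} Bz≤u = K , bound
      where
      K : ℕ
      K = ℤ.∣ mulVec B z i ∣
      bound : ∀ j → j ∉ τ → mulVec B z j ℤ.≤ + addUnits u i K j
      bound j j∉τ with i ≟ j
      ... | yes refl = ℤP.≤-trans (i≤+∣i∣ (mulVec B z i)) (ℤ.+≤+ (≤-addUnits-self u i K))
      ... | no  i≢j  = ℤP.≤-trans (Bz≤u j j∉τ∪⁅i⁆) (ℤ.+≤+ (≤-addUnits u i K j))
        where
        j∉τ∪⁅i⁆ : j ∉ τ ∪ ⁅ i ⁆
        j∉τ∪⁅i⁆ = [ j∉τ , i≢j ∘ sym ∘ SubP.x∈⁅y⁆⇒x≡y i ] ∘ SubP.x∈p∪q⁻ τ ⁅ i ⁆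

    OriginVertexR-unbounded : (∀ k → OriginVertexR B τ (addUnits u i k)) → OriginVertexR B (τ ∪ ⁅ i ⁆) u
    OriginVertexR-unbounded vertex =
      IsVertex-antitone QPts-⋃ origin∈convQ (IsVertex-⋃ step (InConv-mono QPts-⋃ origin∈convQ) vertex)
      where
      step : ∀ k → QPts B τ (addUnits u i k) ⊆ QPts B τ (addUnits u i (suc k))
      step k = QPts-mono id (λ j _ → ≤-addUnit (addUnits u i k) i j)

-- Critical polyhedra above a vertex

¬¬-always-or-fails : ∀ {P : ℕ → Set} → (∀ k → Stable (P k)) → P 0 →
  ¬ ¬ ((∀ k → P k) ⊎ ∃ λ k → P k × ¬ P (suc k))
¬¬-always-or-fails {P} stable p₀ = ¬¬-map decide ¬¬-excluded-middle
  where
  decide : Dec (∃ λ k → P k × ¬ P (suc k)) → (∀ k → P k) ⊎ ∃ λ k → P k × ¬ P (suc k)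
  decide (yes fails) = inj₂ fails
  decide (no ¬fails) = inj₁ always
    where
    always : ∀ k → P k
    always zero    = p₀
    always (suc k) = stable (suc k) λ ¬Pk+1 → ¬fails (k , always k , ¬Pk+1)

module _ {n m} (B : Matℤ n m) where

  open RawMonad (¬¬-Monad {0ℓ}) using (pure; _>>=_)

  CriticalAt : Subset n → (Fin n → ℕ) → Fin n → Set
  CriticalAt τ u i = i ∉ τ → ¬ OriginVertexR B τ (addUnit u i)

  CriticalAt-mono : ∀ {τ τ′ u u′ i} → τ ⊆ₛ τ′ → (∀ j → u j ℕ.≤ u′ j) → CriticalAt τ u i → CriticalAt τ′ u′ i
  CriticalAt-mono {i = i} τ⊆τ′ u≤u′ critical i∉τ′ =
    critical (i∉τ′ ∘ τ⊆τ′) ∘ OriginVertexR-antitone B τ⊆τ′ (λ j _ → addUnit-mono i u≤u′ j)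

  saturateAt : ∀ {τ u} → OriginVertexR B τ u → ∀ i →
    ¬ ¬ (∃₂ λ τ′ u′ → τ ⊆ₛ τ′ × (∀ j → u j ℕ.≤ u′ j) × OriginVertexR B τ′ u′ × CriticalAt τ′ u′ i)
  saturateAt {τ} {u} ov i = ¬¬-map saturated (¬¬-always-or-fails (λ _ → OriginVertexR-stable B) ov)
    where
    saturated : (∀ k → OriginVertexR B τ (addUnits u i k))
              ⊎ ∃ (λ k → OriginVertexR B τ (addUnits u i k) × ¬ OriginVertexR B τ (addUnits u i (suc k))) →
              ∃₂ λ τ′ u′ → τ ⊆ₛ τ′ × (∀ j → u j ℕ.≤ u′ j) × OriginVertexR B τ′ u′ × CriticalAt τ′ u′ i
    saturated (inj₁ unbounded) =
      τ ∪ ⁅ i ⁆ , u , SubP.p⊆p∪q ⁅ i ⁆ , (λ _ → ℕP.≤-refl) , OriginVertexR-unbounded B i unbounded ,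
      λ i∉τ∪⁅i⁆ → ⊥-elim (i∉τ∪⁅i⁆ (SubP.x∈p∪q⁺ (inj₂ (SubP.x∈⁅x⁆ i))))
    saturated (inj₂ (k , ovₖ , ¬ovₖ₊₁)) = τ , addUnits u i k , id , ≤-addUnits u i k , ovₖ , λ _ → ¬ovₖ₊₁

  saturate : ∀ {τ u} → OriginVertexR B τ u → ∀ is →
    ¬ ¬ (∃₂ λ τ′ u′ → (∀ j → u j ℕ.≤ u′ j) × OriginVertexR B τ′ u′ × All (CriticalAt τ′ u′) is)
  saturate ov []       = pure (_ , _ , (λ _ → ℕP.≤-refl) , ov , [])
  saturate ov (i ∷ is) = do
    (τ₁ , u₁ , u≤u₁ , ov₁ , critical₁) ← saturate ov is
    (τ₂ , u₂ , τ₁⊆τ₂ , u₁≤u₂ , ov₂ , criticalᵢ) ← saturateAt ov₁ i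
    pure ( τ₂ , u₂ , (λ j → ℕP.≤-trans (u≤u₁ j) (u₁≤u₂ j)) , ov₂
         , criticalᵢ ∷ All.map (CriticalAt-mono τ₁⊆τ₂ u₁≤u₂) critical₁ )

  ¬¬critical-above : ∀ {v} → OriginVertexR B ∅ v → ¬ ¬ (∃₂ λ τ u → Critical B τ u × (∀ j → v j ℕ.≤ u j))
  ¬¬critical-above ov = ¬¬-map
    (λ (τ , u , v≤u , ovᵤ , critical) → τ , u , (ovᵤ , λ i → All.lookup critical (∈-allFin i)) , v≤u)
    (saturate ov (allFin n))

  vertexIdeal-exceeds : ColumnsIndependent B → ∀ {v τ u} → InVertexIdeal B v → OriginVertexR B τ u →
    ∃ λ i → i ∉ τ × u i ℕ.< v i
  vertexIdeal-exceeds indep {v} {τ} {u} v∈V ov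
    with FinP.any? (λ i → ¬? (i SubP.∈? τ) ×-dec u i ℕP.<? v i)
  ... | yes exceeds = exceeds
  ... | no ¬exceeds = ⊥-elim (v∈V (Equivalence.to (originVertex⇔fiberVertex B v indep) ov∅))
    where
    ov∅ : OriginVertexR B ∅ v
    ov∅ = OriginVertexR-antitone B (SubP.⊆-min τ) (λ i i∉τ → ℕP.≮⇒≥ λ uᵢ<vᵢ → ¬exceeds (i , i∉τ , uᵢ<vᵢ)) ov

module _ {n} {τ : Subset n} {u v : Fin n → ℕ} where

  InMonomialIdealGen-IrredGens⇔ : InMonomialIdealGen (IrredGens τ u) v ⇔ ∃ λ i → i ∉ τ × u i ℕ.< v i
  InMonomialIdealGen-IrredGens⇔ = mk⇔
    (λ (g , (i , i∉τ , g≡) , g≤v) → i , i∉τ , subst (ℕ._≤ v i) (gᵢ≡ g i g≡) (g≤v i))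
    (λ (i , i∉τ , uᵢ<vᵢ) → _ , (i , i∉τ , λ _ → refl) , generator≤ i uᵢ<vᵢ)
    where
    gᵢ≡ : ∀ g i → (∀ j → g j ≡ addUnit (λ _ → 0) i j ℕ.* suc (u i)) → g i ≡ suc (u i)
    gᵢ≡ g i g≡ = trans (g≡ i) (trans (cong (ℕ._* suc (u i)) (addUnit-self _ i)) (ℕP.*-identityˡ _))
    generator≤ : ∀ i → u i ℕ.< v i → ∀ j → addUnit (λ _ → 0) i j ℕ.* suc (u i) ℕ.≤ v j
    generator≤ i uᵢ<vᵢ j with i ≟ j
    ... | yes refl = subst (ℕ._≤ v i) (sym (ℕP.*-identityˡ _)) uᵢ<vᵢ
    ... | no  _    = ℕ.z≤n

theorem3p8 : (n m : ℕ) (B : Matℤ n m) → ColumnsIndependent B →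
    (v : Fin n → ℕ) →
    InVertexIdeal B v ⇔
      ((τ : Subset n) (u : Fin n → ℕ) → Critical B τ u →
        InMonomialIdealGen (IrredGens τ u) v)
theorem3p8 n m B indep v = mk⇔
  (λ v∈V τ u (ov , _) → Equivalence.from InMonomialIdealGen-IrredGens⇔ (vertexIdeal-exceeds B indep v∈V ov))
  (λ v∈⋂ v-vertex → ¬¬critical-above B (Equivalence.from (originVertex⇔fiberVertex B v indep) v-vertex)
     λ (τ , u , critical , v≤u) →
       let (i , _ , uᵢ<vᵢ) = Equivalence.to InMonomialIdealGen-IrredGens⇔ (v∈⋂ τ u critical)
       in ℕP.<⇒≱ uᵢ<vᵢ (v≤u i))
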